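{- Let $\Sigma$ be a finite vocabulary including the property name $r$, let $m$ be a natural number, and let $G=G_{\mathit{disj}}(\Sigma,m)$. Let $E$ be a non-simple, $\mathit{id}$-free path expression over $\Sigma$. Then: (1) either for all even nodes $v$ of $G$, $[\![E]\!]^G(v)\supseteq[\![r]\!]^G(v)$, or for all even nodes $v$ of $G$, $[\![E]\!]^G(v)\supseteq[\![r^-]\!]^G(v)$; (2) either for all odd nodes $v$ of $G$, $[\![E]\!]^G(v)\supseteq[\![r]\!]^G(v)$, or for all odd nodes $v$ of $G$, $[\![E]\!]^G(v)\supseteq[\![r^-]\!]^G(v)$; (3) for all nodes $v$ of $G$, $[\![E]\!]^G(v)\setminus[\![r]\!]^G(v)\neq\emptyset$.
   Context: Fix two disjoint infinite sets $N$ (node names) and $P$ (property names). Path expressions: $E ::= \mathit{id} \mid p \mid p^- \mid E\cup E \mid E\circ E \mid E^*$, $p\in P$; $\mathit{id}$-free means $\mathit{id}$ does not occur; $E$ is over $\Sigma\subseteq N\cup P$ if all its property names lie in $\Sigma$. A path expression is simple if it is a union of expressions of the form $s_1\circ\dots\circ s_n$ with $n\ge1$, where one of the $s_i$ is a property name and all others are $\mathit{id}$. A graph is a finite set of triples $(a,p,b)$, $a,b\in N$, $p\in P$. Semantics (domain $N$): $[\![p]\!]^G=\{(a,b):(a,p,b)\in G\}$, $\mathit{id}$ identity on $N$, $p^-$ inverse, $\cup$ union, $\circ$ composition, $E^*$ reflexive-transitive closure on $N$; $R(x)=\{y:(x,y)\in R\}$. Graph $G_{\mathit{disj}}(\Sigma,m)$: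 let $M=\max(m,3)$ and take $4M$ distinct node names $x_i^j$ ($i\in\{1,2,3,4\}$, $j\in\{1,\dots,M\}$) not in $\Sigma$; for each property name $p\in\Sigma\cap P$ it contains $(x_i^j,p,x_{i\bmod4+1}^{j'})$ for all $i,j,j'$ and $(x_i^j,p,x_i^{j'})$ for $i\in\{2,4\}$ and all $j\neq j'$, and nothing else. The nodes $x_i^j$ with $i\in\{2,4\}$ are called even, those with $i\in\{1,3\}$ odd. -}

module Defs where

open import Data.Nat using (ℕ; _⊔_)
open import Data.Fin using (Fin; zero; suc)
open import Data.Fin.Properties using (_≟_)
open import Data.List using (List; []; _∷_; _++_; concatMap; allFin)
open import Data.List.Membership.Propositional using (_∈_)
open import Data.Product using (_×_; _,_; ∃)
open import Data.Sum using (_⊎_; inj₁; inj₂)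
open import Data.Empty using (⊥)
open import Data.Unit using (⊤)
open import Data.Bool using (Bool; true; false; if_then_else_)
open import Function using (case_of_)
open import Relation.Nullary using (¬_; yes; no)
open import Relation.Binary.PropositionalEquality using (_≡_)
open import Relation.Binary.Construct.Closure.ReflexiveTransitive using (Star)

-- Node names and property names: two disjoint infinite sets.
-- They are modelled as two distinct (hence disjoint) copies of ℕ.
record Node : Set where
  constructor node
  field nodeName : ℕ

record Prop : Set where
  constructor prop
  field propName : ℕ

Vocab : Set
Vocab = List (Node ⊎ Prop)

infixl 6 _∪ₑ_
infixl 7 _∘ₑ_
data PathExpr : Set where
  idₑ   : PathExpr
  pr    : Prop → PathExpr
  inv   : Prop → PathExpr
  _∪ₑ_  : PathExpr → PathExpr → PathExpr
  _∘ₑ_  : PathExpr → PathExpr → PathExpr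
  _*ₑ   : PathExpr → PathExpr

data IdFree : PathExpr → Set where
  pr  : ∀ p → IdFree (pr p)
  inv : ∀ p → IdFree (inv p)
  ∪f  : ∀ {E F} → IdFree E → IdFree F → IdFree (E ∪ₑ F)
  ∘f  : ∀ {E F} → IdFree E → IdFree F → IdFree (E ∘ₑ F)
  *f  : ∀ {E} → IdFree E → IdFree (E *ₑ)

data Over (Σ : Vocab) : PathExpr → Set where
  idₒ : Over Σ idₑ
  pr  : ∀ {p} → inj₂ p ∈ Σ → Over Σ (pr p)
  inv : ∀ {p} → inj₂ p ∈ Σ → Over Σ (inv p)
  ∪o  : ∀ {E F} → Over Σ E → Over Σ F → Over Σ (E ∪ₑ F)
  ∘o  : ∀ {E F} → Over Σ E → Over Σ F → Over Σ (E ∘ₑ F)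
  *o  : ∀ {E} → Over Σ E → Over Σ (E *ₑ)

data IdChain : PathExpr → Set where
  idc : IdChain idₑ
  ∘c  : ∀ {E F} → IdChain E → IdChain F → IdChain (E ∘ₑ F)

data OnePropChain : PathExpr → Set where
  prc : ∀ p → OnePropChain (pr p)
  ∘l  : ∀ {E F} → OnePropChain E → IdChain F → OnePropChain (E ∘ₑ F)
  ∘r  : ∀ {E F} → IdChain E → OnePropChain F → OnePropChain (E ∘ₑ F)

data Simple : PathExpr → Set where
  chain : ∀ {E} → OnePropChain E → Simple E
  ∪s    : ∀ {E F} → Simple E → Simple F → Simple (E ∪ₑ F)

Graph : Set
Graph = List (Node × Prop × Node)

-- Semantics over domain N; ⟦ E ⟧ G a b means (a , b) ∈ ⟦E⟧^G,
-- so ⟦ E ⟧ G a is the set ⟦E⟧^G(a).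
⟦_⟧ : PathExpr → Graph → Node → Node → Set
⟦ idₑ ⟧ G a b = a ≡ b
⟦ pr p ⟧ G a b = (a , p , b) ∈ G
⟦ inv p ⟧ G a b = (b , p , a) ∈ G
⟦ E ∪ₑ F ⟧ G a b = ⟦ E ⟧ G a b ⊎ ⟦ F ⟧ G a b
⟦ E ∘ₑ F ⟧ G a b = ∃ λ c → ⟦ E ⟧ G a c × ⟦ F ⟧ G c b
⟦ E *ₑ ⟧ G a b = Star (⟦ E ⟧ G) a b

bigM : ℕ → ℕ
bigM m = m ⊔ 3

-- Index i ∈ {1,2,3,4} is represented by Fin 4 (zero ↦ 1, …, 3 ↦ 4).
-- nextIdx i represents i mod 4 + 1.
nextIdx : Fin 4 → Fin 4
nextIdx zero = suc zero
nextIdx (suc zero) = suc (suc zero)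
nextIdx (suc (suc zero)) = suc (suc (suc zero))
nextIdx (suc (suc (suc zero))) = zero

IsEvenIdx : Fin 4 → Set
IsEvenIdx zero = ⊥
IsEvenIdx (suc zero) = ⊤
IsEvenIdx (suc (suc zero)) = ⊥
IsEvenIdx (suc (suc (suc zero))) = ⊤

IsOddIdx : Fin 4 → Set
IsOddIdx i = ¬ IsEvenIdx i

isEvenIdx? : Fin 4 → Bool
isEvenIdx? zero = false
isEvenIdx? (suc zero) = true
isEvenIdx? (suc (suc zero)) = false
isEvenIdx? (suc (suc (suc zero))) = true

propsOf : Vocab → List Prop
propsOf [] = []
propsOf (inj₁ _ ∷ Σ) = propsOf Σ
propsOf (inj₂ p ∷ Σ) = p ∷ propsOf Σ

-- G_disj(Σ, m) for a given choice x of the 4M node names x_i^j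
Gdisj : (Σ : Vocab) (m : ℕ) → (Fin 4 → Fin (bigM m) → Node) → Graph
Gdisj Σ m x = concatMap perProp (propsOf Σ)
  where
  perProp : Prop → Graph
  perProp p =
    concatMap (λ i → concatMap (λ j → concatMap (λ j′ →
        (x i j , p , x (nextIdx i) j′) ∷
        (if isEvenIdx? i
           then (case j ≟ j′ of λ { (yes _) → [] ; (no _) → (x i j , p , x i j′) ∷ [] })
           else []))
      (allFin (bigM m))) (allFin (bigM m))) (allFin 4)

-- All property names of Σ label the same edges of G_disj, those of `Step`: from column i to
-- column i mod 4 + 1, and between distinct nodes of an even column. For an id-free E over Σ,
-- ⟦E⟧ therefore contains r or r⁻ uniformly on even nodes, and likewise on odd nodes. This is
-- clear for atoms and survives ∪ and *; it survives E ∘ F because at an even node E first moves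
-- laterally to a sibling (among M ≥ 3 nodes, one avoiding both the start and the target), and
-- at an odd node E reaches the whole adjacent even column, inside which F moves laterally.
-- For (3), a non-simple id-free E has r⁻, a star or a composition in its top-level union. But r
-- has no loops and never leads from an odd node to an odd node, whereas r⁻ goes backwards, a
-- star is reflexive, and a composition returns to its start from an even node and reaches a node
-- of the same parity from an odd one.

module Submission where

open import Defs
open import Data.Nat using (ℕ; _+_; _≤_; s≤s)
open import Data.Nat.Properties using (m≤n⊔m)
open import Data.Fin using (Fin; zero; suc)
open import Data.Fin.Properties using (_≟_)
open import Data.Sum using (_⊎_; inj₁; inj₂; fromInj₂)
open import Data.Product using (_×_; _,_; ∃; ∃₂; proj₁; proj₂; map₂)
open import Data.List using (List; []; _∷_; _++_; concatMap; allFin)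
open import Data.List.Membership.Propositional using (_∈_; find; lose)
open import Data.List.Membership.Propositional.Properties
  using (∈-concatMap⁺; ∈-concatMap⁻; ∈-allFin; ∈-++⁺ˡ; ∈-++⁺ʳ; ∈-++⁻)
open import Data.List.Relation.Unary.Any using (here; there)
open import Data.Unit using (tt)
open import Function using (_∘_; _∋_)
open import Level using (0ℓ)
open import Relation.Nullary using (¬_; yes; no; contradiction)
open import Relation.Binary.Core using (Rel; _⇒_)
open import Relation.Binary.Construct.Closure.ReflexiveTransitive using (ε; _◅_)
open import Relation.Binary.PropositionalEquality using (_≡_; _≢_; refl; sym; trans; cong)

module _ {A : Set} where

  ∈-concatMap-allFin⁺ : ∀ {n} {f : Fin n → List A} {y} k → y ∈ f k → y ∈ concatMap f (allFin n)
  ∈-concatMap-allFin⁺ {f = f} k y∈ = ∈-concatMap⁺ f (lose (∈-allFin k) y∈)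

  ∈-concatMap-allFin⁻ : ∀ {n} {f : Fin n → List A} {y} → y ∈ concatMap f (allFin n) → ∃ λ k → y ∈ f k
  ∈-concatMap-allFin⁻ {n} {f} y∈ = map₂ proj₂ (find (∈-concatMap⁻ f {allFin n} y∈))

propsOf⁺ : ∀ {Σ p} → inj₂ p ∈ Σ → p ∈ propsOf Σ
propsOf⁺ {inj₂ _ ∷ _} (here refl) = here refl
propsOf⁺ {inj₁ _ ∷ _} (there p∈) = propsOf⁺ p∈
propsOf⁺ {inj₂ _ ∷ _} (there p∈) = there (propsOf⁺ p∈)

prevIdx : Fin 4 → Fin 4
prevIdx zero = suc (suc (suc zero))
prevIdx (suc zero) = zero
prevIdx (suc (suc zero)) = suc zero
prevIdx (suc (suc (suc zero))) = suc (suc zero)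

nextIdx-prevIdx : ∀ i → nextIdx (prevIdx i) ≡ i
nextIdx-prevIdx zero = refl
nextIdx-prevIdx (suc zero) = refl
nextIdx-prevIdx (suc (suc zero)) = refl
nextIdx-prevIdx (suc (suc (suc zero))) = refl

prevIdx-nextIdx : ∀ i → prevIdx (nextIdx i) ≡ i
prevIdx-nextIdx zero = refl
prevIdx-nextIdx (suc zero) = refl
prevIdx-nextIdx (suc (suc zero)) = refl
prevIdx-nextIdx (suc (suc (suc zero))) = refl

nextIdx≢id : ∀ i → nextIdx i ≢ i
nextIdx≢id zero ()
nextIdx≢id (suc zero) ()
nextIdx≢id (suc (suc zero)) ()
nextIdx≢id (suc (suc (suc zero))) ()

parity : ∀ i → IsEvenIdx i ⊎ IsOddIdx i
parity zero = inj₂ λ ()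
parity (suc zero) = inj₁ tt
parity (suc (suc zero)) = inj₂ λ ()
parity (suc (suc (suc zero))) = inj₁ tt

data Dir : Set where
  fwd bwd : Dir

neighbour : Dir → Fin 4 → Fin 4
neighbour fwd = nextIdx
neighbour bwd = prevIdx

neighbour-odd : ∀ d i → IsOddIdx i → IsEvenIdx (neighbour d i)
neighbour-odd fwd zero _ = tt
neighbour-odd fwd (suc (suc zero)) _ = tt
neighbour-odd bwd zero _ = tt
neighbour-odd bwd (suc (suc zero)) _ = tt
neighbour-odd _ (suc zero) odd = contradiction tt odd
neighbour-odd _ (suc (suc (suc zero))) odd = contradiction tt odd

neighbour-even : ∀ d i → IsEvenIdx i → IsOddIdx (neighbour d i)
neighbour-even fwd (suc zero) _ ()
neighbour-even fwd (suc (suc (suc zero))) _ ()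
neighbour-even bwd (suc zero) _ ()
neighbour-even bwd (suc (suc (suc zero))) _ ()

∃-avoiding : ∀ {n} → 3 ≤ n → (a b : Fin n) → ∃ λ k → k ≢ a × k ≢ b
∃-avoiding (s≤s (s≤s (s≤s _))) = avoid
  where
  avoid : ∀ {n} (a b : Fin (3 + n)) → ∃ λ k → k ≢ a × k ≢ b
  avoid zero zero = suc zero , (λ ()) , (λ ())
  avoid zero (suc zero) = suc (suc zero) , (λ ()) , (λ ())
  avoid zero (suc (suc _)) = suc zero , (λ ()) , (λ ())
  avoid (suc zero) zero = suc (suc zero) , (λ ()) , (λ ())
  avoid (suc (suc _)) zero = suc zero , (λ ()) , (λ ())
  avoid (suc _) (suc _) = zero , (λ ()) , (λ ())

Pos : ℕ → Set
Pos n = Fin 4 × Fin n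

data Step {n} : Pos n → Pos n → Set where
  forward : ∀ {i i′ j j′} → nextIdx i ≡ i′ → Step (i , j) (i′ , j′)
  lateral : ∀ {i j j′} → IsEvenIdx i → j ≢ j′ → Step (i , j) (i , j′)

module _ {n : ℕ} where

  StepIn : Dir → Pos n → Pos n → Set
  StepIn fwd u v = Step u v
  StepIn bwd u v = Step v u

  step-irreflexive : ∀ {u : Pos n} → ¬ Step u u
  step-irreflexive (forward e) = nextIdx≢id _ e
  step-irreflexive (lateral _ j≢j) = j≢j refl

  ¬step-prevIdx : ∀ i {j k : Fin n} → ¬ Step (i , j) (prevIdx i , k)
  ¬step-prevIdx zero (forward ())
  ¬step-prevIdx (suc zero) (forward ())
  ¬step-prevIdx (suc (suc zero)) (forward ())
  ¬step-prevIdx (suc (suc (suc zero))) (forward ())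

  step-neighbour : ∀ d i (j k : Fin n) → StepIn d (i , j) (neighbour d i , k)
  step-neighbour fwd i j k = forward refl
  step-neighbour bwd i j k = forward (nextIdx-prevIdx i)

  step-lateral : ∀ d {i} {j k : Fin n} → IsEvenIdx i → j ≢ k → StepIn d (i , j) (i , k)
  step-lateral fwd even j≢k = lateral even j≢k
  step-lateral bwd even j≢k = lateral even (j≢k ∘ sym)

  step-fromOdd : ∀ d {i c} {j l : Fin n} → IsOddIdx i → StepIn d (i , j) (c , l) → c ≡ neighbour d i
  step-fromOdd fwd odd (forward e) = sym e
  step-fromOdd fwd odd (lateral even _) = contradiction even odd
  step-fromOdd bwd odd (forward e) = trans (sym (prevIdx-nextIdx _)) (cong prevIdx e)
  step-fromOdd bwd odd (lateral even _) = contradiction even odd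

  ¬step-oddToOdd : ∀ {i c} {j k : Fin n} → IsOddIdx i → IsOddIdx c → ¬ Step (i , j) (c , k)
  ¬step-oddToOdd odd odd′ s with refl ← step-fromOdd fwd odd s = odd′ (neighbour-odd fwd _ odd)

  step-fromSibling : ∀ d {i} {j k : Fin n} {v} → StepIn d (i , j) v → v ≢ (i , k) → StepIn d (i , k) v
  step-fromSibling fwd (forward e) _ = forward e
  step-fromSibling fwd (lateral even _) v≢ = lateral even (λ { refl → v≢ refl })
  step-fromSibling bwd (forward e) _ = forward e
  step-fromSibling bwd (lateral even _) v≢ = lateral even (λ { refl → v≢ refl })

Triple : Set
Triple = Node × Prop × Node

module GdisjMembership (Σ : Vocab) (m : ℕ) (x : Fin 4 → Fin (bigM m) → Node) where

  M : ℕ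
  M = bigM m

  G : Graph
  G = Gdisj Σ m x

  pos : Pos M → Node
  pos (i , j) = x i j

  -- In `Gdisj` the lateral edges of column i are produced by a pattern lambda that cannot be
  -- named here; leaving them abstract as `L` lets unification recover them.
  Block : Fin 4 → Prop → (Fin M → Fin M → List Triple) → List Triple
  Block i p L =
    concatMap (λ j → concatMap (λ j′ → (x i j , p , x (nextIdx i) j′) ∷ L j j′) (allFin M)) (allFin M)

  ∈Block-forward : ∀ {i p L} j j′ → (x i j , p , x (nextIdx i) j′) ∈ Block i p L
  ∈Block-forward j j′ = ∈-concatMap-allFin⁺ j (∈-concatMap-allFin⁺ j′ (here refl))

  ∈Block-lateral : ∀ {i p L y} j j′ → y ∈ L j j′ → y ∈ Block i p L
  ∈Block-lateral j j′ y∈ = ∈-concatMap-allFin⁺ j (∈-concatMap-allFin⁺ j′ (there y∈))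

  ∈Block⁻ : ∀ {i p L y} → y ∈ Block i p L → ∃₂ λ j j′ → y ≡ (x i j , p , x (nextIdx i) j′) ⊎ y ∈ L j j′
  ∈Block⁻ {i} {p} {L} y∈ with ∈-concatMap-allFin⁻ y∈
  ... | j , y∈ⱼ with ∈-concatMap-allFin⁻ {f = λ j′ → (x i j , p , x (nextIdx i) j′) ∷ L j j′} y∈ⱼ
  ...   | j′ , here refl = j , j′ , inj₁ refl
  ...   | j′ , there y∈L = j , j′ , inj₂ y∈L

  module _ {p : Prop} {L₀ L₁ L₂ L₃ : Fin M → Fin M → List Triple} where

    Lateral : Fin 4 → Fin M → Fin M → List Triple
    Lateral zero = L₀
    Lateral (suc zero) = L₁
    Lateral (suc (suc zero)) = L₂
    Lateral (suc (suc (suc zero))) = L₃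

    Blocks : List Triple
    Blocks = Block zero p L₀ ++ Block (suc zero) p L₁
          ++ Block (suc (suc zero)) p L₂ ++ Block (suc (suc (suc zero))) p L₃ ++ []

    ∈Blocks⁺ : ∀ i {y} → y ∈ Block i p (Lateral i) → y ∈ Blocks
    ∈Blocks⁺ zero y∈ = ∈-++⁺ˡ y∈
    ∈Blocks⁺ (suc zero) y∈ = ∈-++⁺ʳ (Block _ _ _) (∈-++⁺ˡ y∈)
    ∈Blocks⁺ (suc (suc zero)) y∈ = ∈-++⁺ʳ (Block _ _ _) (∈-++⁺ʳ (Block _ _ _) (∈-++⁺ˡ y∈))
    ∈Blocks⁺ (suc (suc (suc zero))) y∈ =
      ∈-++⁺ʳ (Block _ _ _) (∈-++⁺ʳ (Block _ _ _) (∈-++⁺ʳ (Block _ _ _) (∈-++⁺ˡ y∈)))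

    ∈Blocks⁻ : ∀ {y} → y ∈ Blocks → ∃ λ i → y ∈ Block i p (Lateral i)
    ∈Blocks⁻ y∈ with ∈-++⁻ (Block _ _ _) y∈
    ... | inj₁ y∈₀ = zero , y∈₀
    ... | inj₂ y∈′ with ∈-++⁻ (Block _ _ _) y∈′
    ...   | inj₁ y∈₁ = suc zero , y∈₁
    ...   | inj₂ y∈″ with ∈-++⁻ (Block _ _ _) y∈″
    ...     | inj₁ y∈₂ = suc (suc zero) , y∈₂
    ...     | inj₂ y∈‴ with ∈-++⁻ (Block _ _ _) y∈‴
    ...       | inj₁ y∈₃ = suc (suc (suc zero)) , y∈₃
    ...       | inj₂ ()

  ∈Gdisj⁺ : ∀ {p u v} → inj₂ p ∈ Σ → Step u v → (pos u , p , pos v) ∈ G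
  ∈Gdisj⁺ p∈ (forward {i} {j = j} {j′} refl) =
    ∈-concatMap⁺ _ (lose (propsOf⁺ p∈) (∈Blocks⁺ i (∈Block-forward j j′)))
  -- The lateral list only reduces once `j ≟ j′` is with-abstracted, so the way into it is bound
  -- to a variable first, whose type then mentions `j ≟ j′`.
  ∈Gdisj⁺ {p} p∈ (lateral {suc zero} {j} {j′} _ j≢j′)
    with embed ← (_ → (x (suc zero) j , p , x (suc zero) j′) ∈ G) ∋
                   (∈-concatMap⁺ _ ∘ lose (propsOf⁺ p∈) ∘ ∈Blocks⁺ (suc zero) ∘ ∈Block-lateral j j′)
    with j ≟ j′
  ... | yes j≡j′ = contradiction j≡j′ j≢j′
  ... | no _ = embed (here refl)
  ∈Gdisj⁺ {p} p∈ (lateral {suc (suc (suc zero))} {j} {j′} _ j≢j′)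
    with embed ← (_ → (x (suc (suc (suc zero))) j , p , x (suc (suc (suc zero))) j′) ∈ G) ∋
                   (∈-concatMap⁺ _ ∘ lose (propsOf⁺ p∈) ∘ ∈Blocks⁺ (suc (suc (suc zero)))
                      ∘ ∈Block-lateral j j′)
    with j ≟ j′
  ... | yes j≡j′ = contradiction j≡j′ j≢j′
  ... | no _ = embed (here refl)

  Linked : Node → Node → Set
  Linked a b = ∃₂ λ u v → Step u v × a ≡ pos u × b ≡ pos v

  linked⇒∈Gdisj : ∀ {a p b} → inj₂ p ∈ Σ → Linked a b → (a , p , b) ∈ G
  linked⇒∈Gdisj p∈ (_ , _ , s , refl , refl) = ∈Gdisj⁺ p∈ s

  ∈Gdisj⁻ : ∀ {a p b} → (a , p , b) ∈ G → Linked a b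
  ∈Gdisj⁻ a∈ with q , _ , a∈q ← find (∈-concatMap⁻ _ {propsOf Σ} a∈) with ∈Blocks⁻ a∈q
  ... | i , a∈ᵢ with ∈Block⁻ a∈ᵢ
  ...   | _ , _ , inj₁ refl = _ , _ , forward refl , refl , refl
  ∈Gdisj⁻ a∈ | zero , _ | _ , _ , inj₂ ()
  ∈Gdisj⁻ a∈ | suc (suc zero) , _ | _ , _ , inj₂ ()
  ∈Gdisj⁻ a∈ | suc zero , _ | j , j′ , inj₂ a∈ₗ with j ≟ j′ | a∈ₗ
  ... | no j≢j′ | here refl = _ , _ , lateral tt j≢j′ , refl , refl
  ... | no _ | there ()
  ... | yes _ | ()
  ∈Gdisj⁻ a∈ | suc (suc (suc zero)) , _ | j , j′ , inj₂ a∈ₗ with j ≟ j′ | a∈ₗ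
  ... | no j≢j′ | here refl = _ , _ , lateral tt j≢j′ , refl , refl
  ... | no _ | there ()
  ... | yes _ | ()

_⨾_ : Rel Node 0ℓ → Rel Node 0ℓ → Rel Node 0ℓ
(S ⨾ T) a b = ∃ λ c → S a c × T c b

atom : Dir → Prop → PathExpr
atom fwd = pr
atom bwd = inv

module Gdisj-r (Σ : Vocab) (r : Prop) (r∈Σ : inj₂ r ∈ Σ) (m : ℕ)
  (x : Fin 4 → Fin (bigM m) → Node)
  (x-injective : ∀ i j i′ j′ → x i j ≡ x i′ j′ → (i ≡ i′) × (j ≡ j′)) where

  open GdisjMembership Σ m x public

  pos-injective : ∀ {u v} → pos u ≡ pos v → u ≡ v
  pos-injective {i , j} {i′ , j′} eq with x-injective i j i′ j′ eq
  ... | refl , refl = refl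

  linked-from : ∀ {u w} → Linked (pos u) w → ∃ λ v → w ≡ pos v × Step u v
  linked-from (_ , v , s , eq , w≡) with refl ← pos-injective eq = v , w≡ , s

  linked-to : ∀ {v w} → Linked w (pos v) → ∃ λ u → w ≡ pos u × Step u v
  linked-to (u , _ , s , w≡ , eq) with refl ← pos-injective eq = u , w≡ , s

  linked⇒step : ∀ {u v} → Linked (pos u) (pos v) → Step u v
  linked⇒step (_ , _ , s , eq , eq′) with refl ← pos-injective eq | refl ← pos-injective eq′ = s

  Edge : Dir → Rel Node 0ℓ
  Edge d = ⟦ atom d r ⟧ G

  edge⁺ : ∀ d {u v} → StepIn d u v → Edge d (pos u) (pos v)
  edge⁺ fwd = ∈Gdisj⁺ r∈Σ
  edge⁺ bwd = ∈Gdisj⁺ r∈Σ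

  edge⁻ : ∀ d {u w} → Edge d (pos u) w → ∃ λ v → w ≡ pos v × StepIn d u v
  edge⁻ fwd = linked-from ∘ ∈Gdisj⁻
  edge⁻ bwd = linked-to ∘ ∈Gdisj⁻

  ¬edge : ∀ {u v} → ¬ Step u v → ¬ Edge fwd (pos u) (pos v)
  ¬edge ¬s = ¬s ∘ linked⇒step ∘ ∈Gdisj⁻

  edge-transfer : ∀ d {p} → inj₂ p ∈ Σ → Edge d ⇒ ⟦ atom d p ⟧ G
  edge-transfer fwd p∈ = linked⇒∈Gdisj p∈ ∘ ∈Gdisj⁻
  edge-transfer bwd p∈ = linked⇒∈Gdisj p∈ ∘ ∈Gdisj⁻

  Covers : Rel Node 0ℓ → Dir → (Fin 4 → Set) → Set
  Covers S d P = ∀ i j → P i → ∀ w → Edge d (x i j) w → S (x i j) w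

  CoversR : Rel Node 0ℓ → Set
  CoversR S = (∃ λ d → Covers S d IsEvenIdx) × (∃ λ d → Covers S d IsOddIdx)

  ExceedsR : Rel Node 0ℓ → Set
  ExceedsR S = ∀ i j → ∃ λ w → S (x i j) w × ¬ Edge fwd (x i j) w

  covers-fwd⊎bwd : ∀ {S P} → (∃ λ d → Covers S d P) → Covers S fwd P ⊎ Covers S bwd P
  covers-fwd⊎bwd (fwd , c) = inj₁ c
  covers-fwd⊎bwd (bwd , c) = inj₂ c

  covers-mono : ∀ {S T d P} → S ⇒ T → Covers S d P → Covers T d P
  covers-mono S⇒T c i j p w e = S⇒T (c i j p w e)

  covers-atom : ∀ d {p P} → inj₂ p ∈ Σ → Covers (⟦ atom d p ⟧ G) d P
  covers-atom d p∈ _ _ _ _ = edge-transfer d p∈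

  covers-lateral : ∀ {S d i j k} → Covers S d IsEvenIdx → IsEvenIdx i → j ≢ k → S (x i j) (x i k)
  covers-lateral {d = d} c even j≢k = c _ _ even _ (edge⁺ d (step-lateral d even j≢k))

  covers-neighbour : ∀ {S d P i} → Covers S d P → P i → ∀ j k → S (x i j) (x (neighbour d i) k)
  covers-neighbour {d = d} c p j k = c _ j p _ (edge⁺ d (step-neighbour d _ j k))

  three≤M : 3 ≤ M
  three≤M = m≤n⊔m m 3

  ⨾-covers-even : ∀ {S T d} → (∃ λ d′ → Covers S d′ IsEvenIdx) → Covers T d IsEvenIdx
    → Covers (S ⨾ T) d IsEvenIdx
  ⨾-covers-even {S} {T} {d} (_ , cS) cT i j even _ e
    with (_ , l) , refl , s ← edge⁻ d e
    with k , k≢j , k≢l ← ∃-avoiding three≤M j l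
    = x i k , covers-lateral {S} cS even (k≢j ∘ sym)
            , cT i k even _ (edge⁺ d (step-fromSibling d s (k≢l ∘ sym ∘ cong proj₂)))

  ⨾-covers-odd : ∀ {S T d} → Covers S d IsOddIdx → (∃ λ d′ → Covers T d′ IsEvenIdx)
    → Covers (S ⨾ T) d IsOddIdx
  ⨾-covers-odd {S} {T} {d} cS (_ , cT) i j odd _ e
    with (_ , l) , refl , s ← edge⁻ d e
    with refl ← step-fromOdd d odd s
    with k , k≢l , _ ← ∃-avoiding three≤M l l
    = x (neighbour d i) k , covers-neighbour {S} cS odd j k
                          , covers-lateral {T} cT (neighbour-odd d i odd) k≢l

  coversR-mono : ∀ {S T} → S ⇒ T → CoversR S → CoversR T
  coversR-mono {S} {T} S⇒T ((d , cₑ) , (d′ , cₒ)) =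
    (d , covers-mono {S} {T} S⇒T cₑ) , (d′ , covers-mono {S} {T} S⇒T cₒ)

  coversR-⨾ : ∀ {S T} → CoversR S → CoversR T → CoversR (S ⨾ T)
  coversR-⨾ {S} {T} (evenS , (d , oddS)) ((d′ , evenT) , _) =
    (d′ , ⨾-covers-even {S} {T} evenS evenT) , (d , ⨾-covers-odd {S} {T} oddS (d′ , evenT))

  ⟦⟧-coversR : ∀ {E} → IdFree E → Over Σ E → CoversR (⟦ E ⟧ G)
  ⟦⟧-coversR (pr _) (pr p∈) = (fwd , covers-atom fwd p∈) , (fwd , covers-atom fwd p∈)
  ⟦⟧-coversR (inv _) (inv p∈) = (bwd , covers-atom bwd p∈) , (bwd , covers-atom bwd p∈)
  ⟦⟧-coversR (∪f {E} {F} e _) (∪o o _) = coversR-mono {⟦ E ⟧ G} {⟦ E ∪ₑ F ⟧ G} inj₁ (⟦⟧-coversR e o)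
  ⟦⟧-coversR (∘f {E} {F} e f) (∘o o o′) =
    coversR-⨾ {⟦ E ⟧ G} {⟦ F ⟧ G} (⟦⟧-coversR e o) (⟦⟧-coversR f o′)
  ⟦⟧-coversR (*f {E} e) (*o o) = coversR-mono {⟦ E ⟧ G} {⟦ E *ₑ ⟧ G} (_◅ ε) (⟦⟧-coversR e o)

  exceedsR-mono : ∀ {S T} → S ⇒ T → ExceedsR S → ExceedsR T
  exceedsR-mono S⇒T wit i j with w , s , ¬e ← wit i j = w , S⇒T s , ¬e

  exceedsR-inv : ∀ {p} → inj₂ p ∈ Σ → ExceedsR (⟦ inv p ⟧ G)
  exceedsR-inv p∈ i j = x (prevIdx i) j , ∈Gdisj⁺ p∈ (forward (nextIdx-prevIdx i)) , ¬edge (¬step-prevIdx i)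

  exceedsR-star : ∀ {E} → ExceedsR (⟦ E *ₑ ⟧ G)
  exceedsR-star i j = x i j , ε , ¬edge step-irreflexive

  exceedsR-⨾ : ∀ {S T} → CoversR S → CoversR T → ExceedsR (S ⨾ T)
  exceedsR-⨾ {S} {T} ((_ , evenS) , (d , oddS)) ((d′ , evenT) , _) i j with parity i
  ... | inj₁ even with k , k≢j , _ ← ∃-avoiding three≤M j j =
    x i j , (x i k , covers-lateral {S} evenS even (k≢j ∘ sym) , covers-lateral {T} evenT even k≢j)
          , ¬edge step-irreflexive
  ... | inj₂ odd =
    x (neighbour d′ (neighbour d i)) j
      , (x (neighbour d i) j , covers-neighbour {S} oddS odd j j
                             , covers-neighbour {T} evenT evenNeighbour j j)
      , ¬edge (¬step-oddToOdd odd (neighbour-even d′ _ evenNeighbour))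
    where
    evenNeighbour : IsEvenIdx (neighbour d i)
    evenNeighbour = neighbour-odd d i odd

  simple⊎exceedsR : ∀ {E} → IdFree E → Over Σ E → Simple E ⊎ ExceedsR (⟦ E ⟧ G)
  simple⊎exceedsR (pr p) _ = inj₁ (chain (prc p))
  simple⊎exceedsR (inv _) (inv p∈) = inj₂ (exceedsR-inv p∈)
  simple⊎exceedsR (∪f {E} {F} e f) (∪o o o′) with simple⊎exceedsR e o | simple⊎exceedsR f o′
  ... | inj₁ s | inj₁ t = inj₁ (∪s s t)
  ... | inj₂ wit | _ = inj₂ (exceedsR-mono {⟦ E ⟧ G} {⟦ E ∪ₑ F ⟧ G} inj₁ wit)
  ... | inj₁ _ | inj₂ wit = inj₂ (exceedsR-mono {⟦ F ⟧ G} {⟦ E ∪ₑ F ⟧ G} inj₂ wit)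
  simple⊎exceedsR (∘f {E} {F} e f) (∘o o o′) =
    inj₂ (exceedsR-⨾ {⟦ E ⟧ G} {⟦ F ⟧ G} (⟦⟧-coversR e o) (⟦⟧-coversR f o′))
  simple⊎exceedsR (*f _) _ = inj₂ exceedsR-star

lemma3p10 : (Σ : Vocab) (r : Prop) → inj₂ r ∈ Σ → (m : ℕ)
    → (x : Fin 4 → Fin (bigM m) → Node)
    → (∀ i j i′ j′ → x i j ≡ x i′ j′ → (i ≡ i′) × (j ≡ j′))
    → (∀ i j → ¬ (inj₁ (x i j) ∈ Σ))
    → (E : PathExpr) → ¬ Simple E → IdFree E → Over Σ E
    → ((∀ i j → IsEvenIdx i → ∀ w → ⟦ pr r ⟧ (Gdisj Σ m x) (x i j) w → ⟦ E ⟧ (Gdisj Σ m x) (x i j) w)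
       ⊎ (∀ i j → IsEvenIdx i → ∀ w → ⟦ inv r ⟧ (Gdisj Σ m x) (x i j) w → ⟦ E ⟧ (Gdisj Σ m x) (x i j) w))
    × ((∀ i j → IsOddIdx i → ∀ w → ⟦ pr r ⟧ (Gdisj Σ m x) (x i j) w → ⟦ E ⟧ (Gdisj Σ m x) (x i j) w)
       ⊎ (∀ i j → IsOddIdx i → ∀ w → ⟦ inv r ⟧ (Gdisj Σ m x) (x i j) w → ⟦ E ⟧ (Gdisj Σ m x) (x i j) w))
    × (∀ i j → ∃ λ w → ⟦ E ⟧ (Gdisj Σ m x) (x i j) w × ¬ ⟦ pr r ⟧ (Gdisj Σ m x) (x i j) w)
lemma3p10 Σ r r∈Σ m x x-injective _ E ¬simple idFree over =
  covers-fwd⊎bwd {⟦ E ⟧ G} (proj₁ coversE) , covers-fwd⊎bwd {⟦ E ⟧ G} (proj₂ coversE) ,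
  fromInj₂ (λ simple → contradiction simple ¬simple) (simple⊎exceedsR idFree over)
  where
  open Gdisj-r Σ r r∈Σ m x x-injective
  coversE : CoversR (⟦ E ⟧ G)
  coversE = ⟦⟧-coversR idFree over
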